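{- Let $A$ be a finite alphabet with $q$ symbols and let $d\ge 2$. Let $f:A^d\to A$ be a bipermutive local rule and let $F:A^{2(d-1)}\to A^{d-1}$ be the no-boundary cellular automaton of length $2(d-1)$ and diameter $d$ defined by $f$. Then the square $L_F$ associated to $F$ is a Latin square of order $N=q^{d-1}$.
   Context: A Latin square of order $N$ is an $N\times N$ matrix with entries in a set of $N$ symbols in which every row and every column is a permutation of the symbols. For $n\ge d$, the no-boundary cellular automaton (CA) $F:A^n\to A^{n-d+1}$ of length $n$ and diameter $d$ with local rule $f:A^d\to A$ is $F(x_0,\dots,x_{n-1})=(f(x_0,\dots,x_{d-1}),f(x_1,\dots,x_d),\dots,f(x_{n-d},\dots,x_{n-1}))$. The rule $f$ is left permutive (resp. right permutive) if for every $z\in A^{d-1}$ the map $A\to A$ obtained by fixing the first $d-1$ (resp. the last $d-1$) arguments of $f$ to $z$ is a permutation of $A$; it is bipermutive if it is both left and right permutive. Fix a bijection $\phi:A^{d-1}\to[N]=\{1,\dots,q^{d-1}\}$ with inverse $\psi$. The square associated to $F:A^{2(d-1)}\to A^{d-1}$ is the $q^{d-1}\times q^{d-1}$ matrix with entries $L_F(i,j)=\phi(F(\psi(i)\,\|\,\psi(j)))$, where $\|$ denotes concatenation of vectors. -}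

module Defs where

open import Data.Nat using (ℕ; zero; suc; _+_; _*_; _∸_; _^_; _≤_; _<_; s≤s; z≤n)
open import Data.Nat.Properties
open import Data.Product using (_×_)
open import Data.Fin using (Fin; toℕ; fromℕ<)
open import Data.Fin.Properties using (toℕ<n)
open import Data.Vec using (Vec; []; _∷_; _∷ʳ_; lookup; tabulate; _++_; cast)
open import Function.Definitions using (Bijective)
open import Function.Bundles using (_↔_; Inverse)
open import Relation.Binary.PropositionalEquality using (_≡_; refl; sym; trans; cong)

-- Permutivity of a local rule f : A^d → A, with d = suc e (so d - 1 = e).
-- Left permutive: fixing the first d-1 arguments to z gives a permutation of A.
LeftPermutive : ∀ {a} {A : Set a} {e : ℕ} → (Vec A (suc e) → A) → Set a
LeftPermutive {A = A} {e} f = (z : Vec A e) → Bijective _≡_ _≡_ (λ (x : A) → f (z ∷ʳ x))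

RightPermutive : ∀ {a} {A : Set a} {e : ℕ} → (Vec A (suc e) → A) → Set a
RightPermutive {A = A} {e} f = (z : Vec A e) → Bijective _≡_ _≡_ (λ (x : A) → f (x ∷ z))

Bipermutive : ∀ {a} {A : Set a} {e : ℕ} → (Vec A (suc e) → A) → Set a
Bipermutive f = LeftPermutive f × RightPermutive f

private
  window-index : ∀ {d n} → d ≤ n → (i : Fin (suc (n ∸ d))) (j : Fin d) → toℕ i + toℕ j < n
  window-index {d} {n} p i j = ≤-trans (+-mono-≤-< (s≤s⁻¹ (toℕ<n i)) (toℕ<n j))
                                       (≤-reflexive (m∸n+n≡m p))
    where
      s≤s⁻¹ : ∀ {m k} → suc m ≤ suc k → m ≤ k
      s≤s⁻¹ (s≤s q) = q

-- No-boundary cellular automaton of length n and diameter d (n ≥ d) with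
-- local rule f : F(x)_i = f(x_i, …, x_{i+d-1}),  i = 0 … n-d.
noBoundaryCA : ∀ {a} {A : Set a} (d n : ℕ) → d ≤ n → (Vec A d → A) → Vec A n → Vec A (suc (n ∸ d))
noBoundaryCA d n p f x =
  tabulate (λ i → f (tabulate (λ j → lookup x (fromℕ< (window-index p i j)))))

private
  len-ok : ∀ e → 1 ≤ e → suc e ≤ e + e
  len-ok e h = +-monoˡ-≤ e h

  out-len : ∀ e → 1 ≤ e → suc ((e + e) ∸ suc e) ≡ e
  out-len (suc k) h = cong suc (m+n∸n≡m k (suc k))

caSquareMap : ∀ {a} {A : Set a} (e : ℕ) → 1 ≤ e → (Vec A (suc e) → A) → Vec A (e + e) → Vec A e
caSquareMap e h f x = cast (out-len e h) (noBoundaryCA (suc e) (e + e) (len-ok e h) f x)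

associatedSquare : ∀ {a} {A : Set a} {e N : ℕ} → (Vec A (e + e) → Vec A e) →
                   (Vec A e ↔ Fin N) → Fin N → Fin N → Fin N
associatedSquare F φ i j = Inverse.to φ (F (Inverse.from φ i ++ Inverse.from φ j))

IsLatinSquare : (N : ℕ) → (Fin N → Fin N → Fin N) → Set
IsLatinSquare N L = ((i : Fin N) → Bijective _≡_ _≡_ (L i))
                  × ((j : Fin N) → Bijective _≡_ _≡_ (λ i → L i j))

-- Write a vector of length 2(d-1) as x ‖ y.  Output cell k of F reads the window
-- (x_k … x_{d-2}, y_0 … y_k).  If x is fixed, left permutivity recovers y_k from the
-- output and y_0 … y_{k-1}, so y is determined from left to right; symmetrically, if y
-- is fixed, right permutivity recovers x from right to left.  Hence x ‖ y ↦ F(x ‖ y)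
-- is cancellative on both sides, and on a finite set that makes every row and column
-- of its table a permutation.
module Submission where

open import Defs
open import Data.Nat using (ℕ; suc; _+_; _^_; _≤_)
open import Data.Fin using (Fin)
open import Data.Vec using (Vec)
open import Function.Bundles using (_↔_)

open import Level using (Level)
open import Algebra.Definitions using (LeftCancellative; RightCancellative)
open import Data.Nat.Base using (zero; _<_; _∸_; s≤s; s≤s⁻¹; z<s)
open import Data.Nat.Properties
  using (_<?_; _≤?_; <-≤-trans; ≮⇒≥; ≰⇒>; +-suc; +-identityʳ; +-monoʳ-<; +-monoˡ-≤;
         +-cancelʳ-≤; m<m+n; m∸n+n≡m; m+n≤o⇒m≤o∸n; m≤o∸n⇒m+n≤o; n<1+n; module ≤-Reasoning)
open import Data.Fin.Base as Fin using (toℕ; fromℕ<; fromℕ; inject₁; punchOut)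
open import Data.Fin.Induction using (<-wellFounded; >-wellFounded)
open import Data.Fin.Properties
  using (_≟_; <⇒≢; any?; pigeonhole; punchOut-injective; toℕ<n; toℕ-injective; toℕ-fromℕ<;
         toℕ-fromℕ; toℕ-inject₁)
open import Data.Vec.Base using (lookup; tabulate; _++_; _∷_; _∷ʳ_; cast)
open import Data.Vec.Properties
  using (lookup∘tabulate; tabulate-cong; cast-sym; ++-injectiveˡ; ++-injectiveʳ;
         lookup-++-<; lookup-++-≥)
open import Data.Vec.Relation.Binary.Pointwise.Extensional using (ext; Pointwise-≡⇒≡)
open import Data.Product.Base using (_,_; proj₁)
open import Function.Base using (_∘_)
open import Function.Bundles using (Inverse; Injection)
open import Function.Definitions using (Injective; Surjective; Bijective)
open import Function.Properties.Inverse using (↔⇒↣; ↔-sym)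
open import Induction.WellFounded using (module All)
open import Relation.Binary.PropositionalEquality
open import Relation.Nullary using (yes; no; contradiction)

private
  variable
    a b : Level
    A : Set a
    m n : ℕ

injective⇒surjective : {g : Fin n → Fin n} → Injective _≡_ _≡_ g → Surjective _≡_ _≡_ g
injective⇒surjective {suc n} {g} g-injective y with any? (λ x → g x ≟ y)
... | yes (x , gx≡y) = x , λ { refl → gx≡y }
... | no y∉image =
  -- g lands in Fin (suc n) ∖ {y} ≅ Fin n, so the pigeonhole principle gives a collision.
  let y≢g : ∀ x → y ≢ g x
      y≢g x y≡gx = y∉image (x , sym y≡gx)
      (i , j , i<j , collision) = pigeonhole (n<1+n n) (λ x → punchOut (y≢g x))
  in contradiction (g-injective (punchOut-injective (y≢g i) (y≢g j) collision)) (<⇒≢ i<j)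

injective⇒bijective : {g : Fin n → Fin n} → Injective _≡_ _≡_ g → Bijective _≡_ _≡_ g
injective⇒bijective g-injective = g-injective , injective⇒surjective g-injective

cancellative⇒latinSquare : {B : Set b} {N : ℕ} (φ : B ↔ Fin N) {_∙_ : B → B → B} →
                           LeftCancellative _≡_ _∙_ → RightCancellative _≡_ _∙_ →
                           IsLatinSquare N (λ i j → Inverse.to φ (Inverse.from φ i ∙ Inverse.from φ j))
cancellative⇒latinSquare φ cancelˡ cancelʳ =
    (λ i → injective⇒bijective λ eq → from-injective (cancelˡ (from i) _ _ (to-injective eq)))
  , (λ j → injective⇒bijective λ eq → from-injective (cancelʳ (from j) _ _ (to-injective eq)))
  where
    open Inverse φ using (to; from)

    to-injective : Injective _≡_ _≡_ to
    to-injective = Injection.injective (↔⇒↣ φ)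

    from-injective : Injective _≡_ _≡_ from
    from-injective = Injection.injective (↔⇒↣ (↔-sym φ))

tabulate-∷ʳ : (g : Fin (suc n) → A) → tabulate g ≡ tabulate (g ∘ inject₁) ∷ʳ g (fromℕ n)
tabulate-∷ʳ {zero}  g = refl
tabulate-∷ʳ {suc n} g = cong (g Fin.zero ∷_) (tabulate-∷ʳ (g ∘ Fin.suc))

cast-injective : .(eq : m ≡ n) {xs ys : Vec A m} → cast eq xs ≡ cast eq ys → xs ≡ ys
cast-injective eq castEq = trans (sym (cast-sym eq castEq)) (cast-sym eq refl)

module _ {e : ℕ} (f : Vec A (suc e) → A) where

  leftPermutive-cancel-last : LeftPermutive f → {g g′ : Fin (suc e) → A} →
                              (∀ j → g (inject₁ j) ≡ g′ (inject₁ j)) →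
                              f (tabulate g) ≡ f (tabulate g′) → g (fromℕ e) ≡ g′ (fromℕ e)
  leftPermutive-cancel-last left {g} {g′} init≡ out≡ =
    proj₁ (left (tabulate (g ∘ inject₁))) (begin
      f (tabulate (g ∘ inject₁) ∷ʳ g (fromℕ e))    ≡⟨ cong f (tabulate-∷ʳ g) ⟨
      f (tabulate g)                                ≡⟨ out≡ ⟩
      f (tabulate g′)                               ≡⟨ cong f (tabulate-∷ʳ g′) ⟩
      f (tabulate (g′ ∘ inject₁) ∷ʳ g′ (fromℕ e))  ≡⟨ cong (λ z → f (z ∷ʳ g′ (fromℕ e))) (tabulate-cong init≡) ⟨
      f (tabulate (g ∘ inject₁) ∷ʳ g′ (fromℕ e))   ∎)
    where open ≡-Reasoning

  rightPermutive-cancel-head : RightPermutive f → {g g′ : Fin (suc e) → A} →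
                               (∀ j → g (Fin.suc j) ≡ g′ (Fin.suc j)) →
                               f (tabulate g) ≡ f (tabulate g′) → g Fin.zero ≡ g′ Fin.zero
  rightPermutive-cancel-head right {g} {g′} tail≡ out≡ =
    proj₁ (right (tabulate (g ∘ Fin.suc)))
      (trans out≡ (cong (λ z → f (g′ Fin.zero ∷ z)) (sym (tabulate-cong tail≡))))

module _ {e n : ℕ} (d≤n : suc e ≤ n) (f : Vec A (suc e) → A) where

  private
    ca : Vec A n → Vec A (suc (n ∸ suc e))
    ca = noBoundaryCA (suc e) n d≤n f

  cell : (k : ℕ) → .(k + suc e ≤ n) → Fin (suc e) → Fin n
  cell k k+d≤n j = fromℕ< (<-≤-trans (+-monoʳ-< k (toℕ<n j)) k+d≤n)

  toℕ-cell : ∀ k .(k+d≤n : k + suc e ≤ n) j → toℕ (cell k k+d≤n j) ≡ k + toℕ j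
  toℕ-cell k k+d≤n j = toℕ-fromℕ< _

  window : Vec A n → (k : ℕ) → .(k + suc e ≤ n) → Vec A (suc e)
  window v k k+d≤n = tabulate (lookup v ∘ cell k k+d≤n)

  window-cong : ∀ v {k k′} → k ≡ k′ → .(k+d≤n : k + suc e ≤ n) .(k′+d≤n : k′ + suc e ≤ n) →
                window v k k+d≤n ≡ window v k′ k′+d≤n
  window-cong v refl _ _ = refl

  outputCell : (k : ℕ) → .(k + suc e ≤ n) → Fin (suc (n ∸ suc e))
  outputCell k k+d≤n = fromℕ< (s≤s (m+n≤o⇒m≤o∸n k k+d≤n))

  window-fits : (i : Fin (suc (n ∸ suc e))) → toℕ i + suc e ≤ n
  window-fits i = m≤o∸n⇒m+n≤o (toℕ i) d≤n (s≤s⁻¹ (toℕ<n i))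

  lookup-noBoundaryCA : ∀ v k .(k+d≤n : k + suc e ≤ n) →
                        lookup (ca v) (outputCell k k+d≤n) ≡ f (window v k k+d≤n)
  -- Up to its irrelevant bound proofs, noBoundaryCA is literally the tabulate below.
  lookup-noBoundaryCA v k k+d≤n = begin
    lookup (ca v) (outputCell k k+d≤n)
      ≡⟨ lookup∘tabulate (λ i → f (window v (toℕ i) (window-fits i))) (outputCell k k+d≤n) ⟩
    f (window v (toℕ (outputCell k k+d≤n)) (window-fits (outputCell k k+d≤n)))
      ≡⟨ cong f (window-cong v (toℕ-fromℕ< _) (window-fits (outputCell k k+d≤n)) k+d≤n) ⟩
    f (window v k k+d≤n) ∎
    where open ≡-Reasoning

  noBoundaryCA-windows : ∀ {v v′} → ca v ≡ ca v′ →
                         ∀ k .(k+d≤n : k + suc e ≤ n) → f (window v k k+d≤n) ≡ f (window v′ k k+d≤n)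
  noBoundaryCA-windows {v} {v′} same k k+d≤n = begin
    f (window v k k+d≤n)                   ≡⟨ lookup-noBoundaryCA v k k+d≤n ⟨
    lookup (ca v) (outputCell k k+d≤n)     ≡⟨ cong (λ u → lookup u (outputCell k k+d≤n)) same ⟩
    lookup (ca v′) (outputCell k k+d≤n)    ≡⟨ lookup-noBoundaryCA v′ k k+d≤n ⟩
    f (window v′ k k+d≤n)                  ∎
    where open ≡-Reasoning

  noBoundaryCA-prefix-injective : LeftPermutive f → ∀ {v v′} → ca v ≡ ca v′ →
                                  (∀ i → toℕ i < e → lookup v i ≡ lookup v′ i) → v ≡ v′
  noBoundaryCA-prefix-injective left {v} {v′} same prefix =
    Pointwise-≡⇒≡ (ext (All.wfRec <-wellFounded _ Agree agree))
    where
      Agree : Fin n → Set _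
      Agree i = lookup v i ≡ lookup v′ i

      agree : ∀ i → (∀ {j} → toℕ j < toℕ i → Agree j) → Agree i
      agree i earlier with toℕ i <? e
      ... | yes i<e = prefix i i<e
      ... | no i≮e = subst Agree last-cell
                       (leftPermutive-cancel-last f left {lookup v ∘ cell k k+d≤n} {lookup v′ ∘ cell k k+d≤n}
                          init-agree (noBoundaryCA-windows {v} {v′} same k k+d≤n))
        where
          k = toℕ i ∸ e

          k+e≡i : k + e ≡ toℕ i
          k+e≡i = m∸n+n≡m (≮⇒≥ i≮e)

          k+d≤n : k + suc e ≤ n
          k+d≤n = subst (_≤ n) (sym (trans (+-suc k e) (cong suc k+e≡i))) (toℕ<n i)

          init-agree : ∀ j → Agree (cell k k+d≤n (inject₁ j))
          init-agree j = earlier (begin-strict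
            toℕ (cell k k+d≤n (inject₁ j))  ≡⟨ toℕ-cell k k+d≤n (inject₁ j) ⟩
            k + toℕ (inject₁ j)              ≡⟨ cong (k +_) (toℕ-inject₁ j) ⟩
            k + toℕ j                        <⟨ +-monoʳ-< k (toℕ<n j) ⟩
            k + e                            ≡⟨ k+e≡i ⟩
            toℕ i                            ∎)
            where open ≤-Reasoning

          last-cell : cell k k+d≤n (fromℕ e) ≡ i
          last-cell = toℕ-injective (trans (toℕ-cell k k+d≤n (fromℕ e))
                                           (trans (cong (k +_) (toℕ-fromℕ e)) k+e≡i))

  noBoundaryCA-suffix-injective : RightPermutive f → ∀ {v v′} → ca v ≡ ca v′ →
                                  (∀ i → n ≤ toℕ i + e → lookup v i ≡ lookup v′ i) → v ≡ v′
  noBoundaryCA-suffix-injective right {v} {v′} same suffix =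
    Pointwise-≡⇒≡ (ext (All.wfRec >-wellFounded _ Agree agree))
    where
      Agree : Fin n → Set _
      Agree i = lookup v i ≡ lookup v′ i

      agree : ∀ i → (∀ {j} → toℕ i < toℕ j → Agree j) → Agree i
      agree i later with n ≤? toℕ i + e
      ... | yes n≤i+e = suffix i n≤i+e
      ... | no n≰i+e = subst Agree first-cell
                         (rightPermutive-cancel-head f right {lookup v ∘ cell k k+d≤n} {lookup v′ ∘ cell k k+d≤n}
                            tail-agree (noBoundaryCA-windows {v} {v′} same k k+d≤n))
        where
          k = toℕ i

          k+d≤n : k + suc e ≤ n
          k+d≤n = subst (_≤ n) (sym (+-suc k e)) (≰⇒> n≰i+e)

          tail-agree : ∀ j → Agree (cell k k+d≤n (Fin.suc j))
          tail-agree j = later (subst (k <_) (sym (toℕ-cell k k+d≤n (Fin.suc j))) (m<m+n k z<s))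

          first-cell : cell k k+d≤n Fin.zero ≡ i
          first-cell = toℕ-injective (trans (toℕ-cell k k+d≤n Fin.zero) (+-identityʳ k))

module _ {e : ℕ} (e≥1 : 1 ≤ e) (f : Vec A (suc e) → A) where

  private
    d≤2e : suc e ≤ e + e
    d≤2e = +-monoˡ-≤ e e≥1

  caSquareMap-cancelˡ : LeftPermutive f → LeftCancellative _≡_ (λ x y → caSquareMap e e≥1 f (x ++ y))
  caSquareMap-cancelˡ left x y y′ same = ++-injectiveʳ x x
    (noBoundaryCA-prefix-injective d≤2e f left (cast-injective _ same) λ i i<e →
      trans (lookup-++-< x y i i<e) (sym (lookup-++-< x y′ i i<e)))

  caSquareMap-cancelʳ : RightPermutive f → RightCancellative _≡_ (λ x y → caSquareMap e e≥1 f (x ++ y))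
  caSquareMap-cancelʳ right y x x′ same = ++-injectiveˡ x x′
    (noBoundaryCA-suffix-injective d≤2e f right (cast-injective _ same) λ i 2e≤i+e →
      let e≤i = +-cancelʳ-≤ e e (toℕ i) 2e≤i+e
      in trans (lookup-++-≥ x y i e≤i) (sym (lookup-++-≥ x′ y i e≤i)))

lemma2 : (q e : ℕ) → (e≥1 : 1 ≤ e) →
         (f : Vec (Fin q) (suc e) → Fin q) → Bipermutive f →
         (φ : Vec (Fin q) e ↔ Fin (q ^ e)) →
         IsLatinSquare (q ^ e) (associatedSquare (caSquareMap e e≥1 f) φ)
lemma2 q e e≥1 f (left , right) φ =
  cancellative⇒latinSquare φ (caSquareMap-cancelˡ e≥1 f left) (caSquareMap-cancelʳ e≥1 f right)
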